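{- Let $\Delta$ be a countable connected homogeneous digraph that embeds the digraph $A$ on three vertices $v,w,x$ with arcs $w\to x$ and $x\to v$ and with $v,w$ non-adjacent (no arc in either direction). Then $\mathrm{Mon}(\Delta)=\mathrm{End}(\Delta)$, and $\Delta$ is not HH-homogeneous.
   Context: A digraph is a set of vertices with an irreflexive binary arc relation $\to$ containing no 2-cycles (never both $x\to y$ and $y\to x$). Homogeneous: every isomorphism between finite induced subdigraphs extends to an automorphism. $\mathrm{End}(\Delta)$ is the monoid of endomorphisms (arc-preserving maps $\Delta\to\Delta$) and $\mathrm{Mon}(\Delta)$ the injective endomorphisms. $\Delta$ is HH-homogeneous if every arc-preserving map between finite induced subdigraphs of $\Delta$ extends to an endomorphism of $\Delta$. Connected means the underlying undirected graph is connected. -}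

module Defs where

open import Data.Nat using (ℕ)
open import Data.Fin using (Fin)
open import Data.Product using (Σ; ∃; _×_; _,_)
open import Relation.Nullary using (¬_)
open import Relation.Binary.PropositionalEquality using (_≡_)
open import Function.Definitions using (Injective; Bijective)

record Digraph : Set₁ where
  field
    V     : Set
    _⇒_   : V → V → Set
    irrefl : ∀ {x} → ¬ (x ⇒ x)
    asym   : ∀ {x y} → x ⇒ y → ¬ (y ⇒ x)

module _ (Δ : Digraph) where
  open Digraph Δ

  Countable : Set
  Countable = Σ (V → ℕ) λ c → Injective _≡_ _≡_ c

  data UPath : V → V → Set where
    here : ∀ {x} → UPath x x
    fwd  : ∀ {x y z} → x ⇒ y → UPath y z → UPath x z
    bwd  : ∀ {x y z} → y ⇒ x → UPath y z → UPath x z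

  Connected : Set
  Connected = ∀ x y → UPath x y

  IsEndo : (V → V) → Set
  IsEndo f = ∀ {x y} → x ⇒ y → f x ⇒ f y

  IsAut : (V → V) → Set
  IsAut g = Bijective _≡_ _≡_ g × (∀ {x y} → (x ⇒ y → g x ⇒ g y) × (g x ⇒ g y → x ⇒ y))

  EndEqMon : Set
  EndEqMon = ∀ (f : V → V) → IsEndo f → Injective _≡_ _≡_ f

  -- A finite induced subdigraph is given by an injective enumeration a : Fin n → V
  -- of its vertices; a map on it is given by the images b : Fin n → V (b i = image of a i).

  Homogeneous : Set
  Homogeneous = ∀ (n : ℕ) (a b : Fin n → V) →
    Injective _≡_ _≡_ a → Injective _≡_ _≡_ b →
    (∀ i j → (a i ⇒ a j → b i ⇒ b j) × (b i ⇒ b j → a i ⇒ a j)) →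
    Σ (V → V) λ g → IsAut g × (∀ i → g (a i) ≡ b i)

  HH-Homogeneous : Set
  HH-Homogeneous = ∀ (n : ℕ) (a b : Fin n → V) →
    Injective _≡_ _≡_ a →
    (∀ i j → a i ⇒ a j → b i ⇒ b j) →
    Σ (V → V) λ g → IsEndo g × (∀ i → g (a i) ≡ b i)

  -- Δ embeds (as induced subdigraph) A: vertices v,w,x with w→x, x→v, v,w non-adjacent.
  -- (Distinctness of v,w,x and absence of the other arcs follow from irreflexivity/asymmetry.)
  EmbedsA : Set
  EmbedsA = Σ V λ v → Σ V λ w → Σ V λ x →
    (w ⇒ x) × (x ⇒ v) × ¬ (v ⇒ w) × ¬ (w ⇒ v)

module Submission where

-- Call two distinct, non-adjacent vertices an independent pair.
-- In a homogeneous digraph all independent pairs lie in one orbit of the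
-- automorphism group (the map between two of them is an isomorphism of
-- two-vertex induced subdigraphs).  Transporting the copy w → x → v of A,
-- whose ends v, w form an independent pair, shows that every independent
-- pair (a , b) is joined by a directed 2-path b → c → a.
-- An endomorphism f cannot identify the ends of a 2-path b → c → a, since
-- f b → f c → f a = f b would be a 2-cycle, nor the ends of an arc, by
-- irreflexivity.  Hence endomorphisms are injective (countability supplies
-- the decidable equality needed to split distinct from equal vertices),
-- while the arc-preserving map sending the independent pair {v , w} to a
-- single vertex has no extension to an endomorphism, so Δ is not
-- HH-homogeneous.

open import Defs
open import Data.Fin using (Fin; zero; suc)
open import Data.Nat using (_≟_)
open import Data.Product using (Σ; ∃; _×_; _,_; proj₁)
open import Data.Empty using (⊥-elim)
open import Function.Definitions using (Injective)
open import Relation.Nullary using (¬_; yes; no)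
open import Relation.Nullary.Decidable using (map′)
open import Relation.Binary.Definitions using (DecidableEquality)
open import Relation.Binary.PropositionalEquality using (_≡_; refl; sym; trans; subst; cong)

countable⇒decEq : (Δ : Digraph) → Countable Δ → DecidableEquality (Digraph.V Δ)
countable⇒decEq Δ (c , c-inj) a b = map′ c-inj (cong c) (c a ≟ c b)

module _ (Δ : Digraph) where
  open Digraph Δ

  record Independent (a b : V) : Set where
    field
      distinct : ¬ (a ≡ b)
      no-ab    : ¬ (a ⇒ b)
      no-ba    : ¬ (b ⇒ a)

  path₂-distinct : ∀ {a b c} → b ⇒ c → c ⇒ a → ¬ (a ≡ b)
  path₂-distinct bc ca refl = asym bc ca

  A-ends-independent : ((v , w , x , _) : EmbedsA Δ) → Independent v w
  A-ends-independent (v , w , x , wx , xv , ¬vw , ¬wv) = record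
    { distinct = path₂-distinct wx xv ; no-ab = ¬vw ; no-ba = ¬wv }

  pair : V → V → Fin 2 → V
  pair a b zero    = a
  pair a b (suc _) = b

  pair-injective : ∀ {a b} → Independent a b → Injective _≡_ _≡_ (pair a b)
  pair-injective ind {zero}     {zero}     e = refl
  pair-injective ind {zero}     {suc zero} e = ⊥-elim (Independent.distinct ind e)
  pair-injective ind {suc zero} {zero}     e = ⊥-elim (Independent.distinct ind (sym e))
  pair-injective ind {suc zero} {suc zero} e = refl

  pair-arcless : ∀ {a b} → Independent a b → ∀ i j → ¬ (pair a b i ⇒ pair a b j)
  pair-arcless ind zero       zero       = irrefl
  pair-arcless ind zero       (suc zero) = Independent.no-ab ind
  pair-arcless ind (suc zero) zero       = Independent.no-ba ind
  pair-arcless ind (suc zero) (suc zero) = irrefl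

  -- Homogeneity makes the automorphism group transitive on independent pairs;
  -- only the arc-preservation of the automorphism is needed below.
  independent-transitive : Homogeneous Δ → ∀ {a b a′ b′} →
    Independent a b → Independent a′ b′ →
    Σ (V → V) λ g → (∀ {x y} → x ⇒ y → g x ⇒ g y) × g a ≡ a′ × g b ≡ b′
  independent-transitive hom ind ind′
    with hom 2 (pair _ _) (pair _ _) (pair-injective ind) (pair-injective ind′)
           (λ i j → (λ p → ⊥-elim (pair-arcless ind i j p))
                  , (λ p → ⊥-elim (pair-arcless ind′ i j p)))
  ... | g , (_ , arcs) , g-pair = g , proj₁ arcs , g-pair zero , g-pair (suc zero)

  -- Every independent pair (a , b) is the image of the ends of A, hence is
  -- joined by a 2-path b → c → a.
  independent-joined : Homogeneous Δ → EmbedsA Δ →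
    ∀ {a b} → Independent a b → ∃ λ c → b ⇒ c × c ⇒ a
  independent-joined hom A@(v , w , x , wx , xv , _) ind
    with independent-transitive hom (A-ends-independent A) ind
  ... | g , g-arcs , refl , refl = g x , g-arcs wx , g-arcs xv

  endo-separates-path₂ : ∀ {f a b c} → IsEndo Δ f → b ⇒ c → c ⇒ a → ¬ (f a ≡ f b)
  endo-separates-path₂ {f} endo bc ca fa≡fb =
    asym (endo bc) (subst (f _ ⇒_) fa≡fb (endo ca))

  endo-separates-arc : ∀ {f a b} → IsEndo Δ f → a ⇒ b → ¬ (f a ≡ f b)
  endo-separates-arc {f} endo ab fa≡fb = irrefl (subst (f _ ⇒_) (sym fa≡fb) (endo ab))

  endo-injective : Countable Δ → Homogeneous Δ → EmbedsA Δ → EndEqMon Δ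
  endo-injective cnt hom A f endo {a} {b} fa≡fb with countable⇒decEq Δ cnt a b
  ... | yes a≡b = a≡b
  ... | no  a≢b with independent-joined hom A independent
    where
    independent : Independent a b
    independent = record
      { distinct = a≢b
      ; no-ab    = λ ab → endo-separates-arc endo ab fa≡fb
      ; no-ba    = λ ba → endo-separates-arc endo ba (sym fa≡fb) }
  ...   | c , bc , ca = ⊥-elim (endo-separates-path₂ endo bc ca fa≡fb)

  -- Second conclusion: collapsing the independent ends v , w of A onto v is
  -- (vacuously) arc-preserving, but an extension would identify the ends of
  -- the 2-path w → x → v.
  not-HH-homogeneous : EmbedsA Δ → ¬ HH-Homogeneous Δ
  not-HH-homogeneous A@(v , w , x , wx , xv , _) hh
    with hh 2 (pair v w) (λ _ → v) (pair-injective (A-ends-independent A))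
            (λ i j p → ⊥-elim (pair-arcless (A-ends-independent A) i j p))
  ... | g , endo , g-pair =
    endo-separates-path₂ endo wx xv (trans (g-pair zero) (sym (g-pair (suc zero))))

corollary5p18 : (Δ : Digraph) → Countable Δ → Connected Δ → Homogeneous Δ → EmbedsA Δ →
    EndEqMon Δ × ¬ HH-Homogeneous Δ
corollary5p18 Δ cnt _ hom A = endo-injective Δ cnt hom A , not-HH-homogeneous Δ A
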